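{- Let $k\ge2$ and $n\ge k+1$, and let $C\subseteq[n]$ have cardinality $k+1$. Then $C$ is $k$-bad for $P_n^2$ if and only if $C=\{s,s+1,\ldots,s+k\}$ for some $1\le s\le n-k$. Hence $q_{k+1}(P_n^2,k)=n-k$.
   Context: The squared path $P_n^2$ is the graph on $[n]=\{1,\dots,n\}$ whose edges are the pairs $\{i,i+1\}$ ($1\le i\le n-1$) and $\{i,i+2\}$ ($1\le i\le n-2$). For a graph $G$ on $[n]$, a subset $C\subseteq[n]$ is called $k$-bad if $|C|\ge k$ and every $k$-element subset of $C$ induces a connected subgraph of $G$. $q_m(G,k)$ denotes the number of $k$-bad subsets $C\subseteq[n]$ with $|C|=m$. -}

module Defs where

open import Level using (0ℓ)
open import Data.Nat using (ℕ; suc; _+_; _≤_)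
open import Data.Fin using (Fin; toℕ)
open import Data.Fin.Subset using (Subset; _∈_; _⊆_; ∣_∣)
open import Data.List using (List; length)
open import Data.List.Relation.Unary.Unique.Propositional using (Unique)
import Data.List.Membership.Propositional as L
open import Data.Product using (Σ; _×_; ∃)
open import Data.Sum using (_⊎_)
open import Relation.Binary.PropositionalEquality using (_≡_)
open import Function.Bundles using (_⇔_)

-- A graph on [n]: vertex i ∈ [n] is represented by (i - 1 : Fin n);
-- the graph is given by its adjacency relation.
Graph : ℕ → Set₁
Graph n = Fin n → Fin n → Set

P² : (n : ℕ) → Graph n
P² n i j = (toℕ j ≡ toℕ i + 1 ⊎ toℕ j ≡ toℕ i + 2)
         ⊎ (toℕ i ≡ toℕ j + 1 ⊎ toℕ i ≡ toℕ j + 2)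

data Reach {n : ℕ} (G : Graph n) (S : Subset n) : Fin n → Fin n → Set where
  here  : ∀ {x} → x ∈ S → Reach G S x x
  there : ∀ {x z y} → x ∈ S → G x z → Reach G S z y → Reach G S x y

InducesConnected : {n : ℕ} → Graph n → Subset n → Set
InducesConnected G S = ∀ x y → x ∈ S → y ∈ S → Reach G S x y

IsBad : {n : ℕ} → Graph n → ℕ → Subset n → Set
IsBad G k C = k ≤ ∣ C ∣ × (∀ D → D ⊆ C → ∣ D ∣ ≡ k → InducesConnected G D)

HasCount : {n : ℕ} → (Subset n → Set) → ℕ → Set
HasCount {n} P m = Σ (List (Subset n)) λ xs →
  Unique xs × length xs ≡ m × (∀ C → (C L.∈ xs) ⇔ P C)

q≡ : {n : ℕ} → (m : ℕ) → Graph n → ℕ → ℕ → Set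
q≡ m G k r = HasCount (λ C → IsBad G k C × ∣ C ∣ ≡ m) r

-- Every edge of P²ₙ joins positions at distance at most 2, so a set D induces a
-- connected subgraph iff no two consecutive positions strictly between elements of D
-- are both vacant. If C has k + 1 ≥ 3 elements and a gap, deleting a suitable element
-- (a third one, or a neighbour of the gap) leaves a k-subset with such a double vacancy;
-- hence k-bad (k+1)-sets are convex, i.e. intervals. Conversely a k-subset of an
-- interval of length k + 1 misses a single position. The intervals are counted by
-- their n − k possible starting points.
module Submission where

open import Defs
open import Data.Nat using (ℕ; zero; suc; _+_; _∸_; _≤_; _<_; z≤n; s≤s; s≤s⁻¹; z<s)
open import Data.Nat.Properties
  using ( _≟_; suc-injective; ≤-refl; ≤-reflexive; ≤-trans; ≤-antisym; ≤-total; <-trans; <-asym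
        ; <-irrefl; 1+n≢n; <-cmp; <⇒≤; <⇒≢; <⇒≱; ≤∧≢⇒<; n≤1+n; n<1+n; m<n⇒m<1+n; m≤m+n; m≤n+m
        ; m<m+n; +-monoʳ-≤; +-comm; +-suc; m∸n+n≡m; m+n≤o⇒m≤o∸n; module ≤-Reasoning)
open import Data.Fin using (Fin; toℕ; zero; suc; fromℕ<)
open import Data.Fin.Properties using (toℕ-injective; toℕ-fromℕ<; toℕ<n; any?)
open import Data.Fin.Subset
  using (Subset; inside; outside; _∈_; _∉_; _⊆_; ∣_∣; _-_; ⊥; Nonempty; Empty)
open import Data.Fin.Subset.Properties
  using ( _∈?_; ∉⊥; ∣⊥∣≡0; ∣p∣≤n; Empty-unique; ⊆-antisym; p─⊥≡p; p─q⊆p; p⊆q⇒∣p∣≤∣q∣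
        ; x∈p∧x≢y⇒x∈p-y; x∈p⇒∣p-x∣<∣p∣)
open import Data.Vec.Base using ([]; _∷_; here; there)
open import Data.List using (applyUpTo)
open import Data.List.Properties using (length-applyUpTo)
import Data.List.Membership.Propositional as Listₘ
open import Data.List.Membership.Propositional.Properties using (∈-applyUpTo⁺; ∈-applyUpTo⁻)
open import Data.List.Relation.Unary.Unique.Propositional.Properties using (applyUpTo⁺₁)
open import Data.Product using (Σ; _×_; ∃; _,_; proj₁; proj₂; map; map₁)
open import Data.Sum using (_⊎_; inj₁; inj₂; [_,_]′; swap)
open import Relation.Nullary using (¬_; Dec; yes; no; contradiction)
open import Relation.Nullary.Decidable using (_×-dec_; decidable-stable)
open import Relation.Binary.Definitions using (Symmetric; tri<; tri≈; tri>)
open import Relation.Binary.PropositionalEquality using (_≡_; _≢_; refl; sym; trans; cong; subst)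
open import Function using (_∘_)
open import Function.Bundles using (_⇔_; mk⇔; Equivalence)
open import Function.Construct.Composition using (_⇔-∘_)
open import Function.Construct.Symmetry using (⇔-sym)

open Equivalence using (to; from)

private variable
  n k i : ℕ
  p q C D : Subset n
  x y z : Fin n
  G : Graph n

∣p∣≤1+∣p-x∣ : ∀ (p : Subset n) x → ∣ p ∣ ≤ suc ∣ p - x ∣
∣p∣≤1+∣p-x∣ (outside ∷ p) zero    = ≤-trans (n≤1+n ∣ p ∣) (s≤s (≤-reflexive (cong ∣_∣ (sym (p─⊥≡p p)))))
∣p∣≤1+∣p-x∣ (inside  ∷ p) zero    = s≤s (≤-reflexive (cong ∣_∣ (sym (p─⊥≡p p))))
∣p∣≤1+∣p-x∣ (outside ∷ p) (suc x) = ∣p∣≤1+∣p-x∣ p x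
∣p∣≤1+∣p-x∣ (inside  ∷ p) (suc x) = s≤s (∣p∣≤1+∣p-x∣ p x)

x∈p⇒1+∣p-x∣≡∣p∣ : ∀ {p : Subset n} {x} → x ∈ p → suc ∣ p - x ∣ ≡ ∣ p ∣
x∈p⇒1+∣p-x∣≡∣p∣ {p = p} {x} x∈p = ≤-antisym (x∈p⇒∣p-x∣<∣p∣ x∈p) (∣p∣≤1+∣p-x∣ p x)

x∉p-x : ∀ (p : Subset n) x → x ∉ p - x
x∉p-x (_ ∷ p) zero    ()
x∉p-x (_ ∷ p) (suc x) (there x∈p-x) = x∉p-x p x x∈p-x

x∈p-y⇒x≢y : x ∈ p - y → x ≢ y
x∈p-y⇒x≢y {p = p} {y = y} x∈p-y refl = x∉p-x p y x∈p-y

0<∣p∣⇒nonempty : ∀ (p : Subset n) → 0 < ∣ p ∣ → Nonempty p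
0<∣p∣⇒nonempty (inside  ∷ p) _      = zero , here
0<∣p∣⇒nonempty (outside ∷ p) 0<∣p∣ = map suc there (0<∣p∣⇒nonempty p 0<∣p∣)

3≤∣p∣⇒third-element : 3 ≤ ∣ p ∣ → ∀ a b → ∃ λ w → w ∈ p × w ≢ a × w ≢ b
3≤∣p∣⇒third-element {p = p} 3≤∣p∣ a b =
  let w , w∈p-a-b = 0<∣p∣⇒nonempty (p - a - b) 0<∣p-a-b∣
      w∈p-a       = p─q⊆p (p - a) _ w∈p-a-b
  in w , p─q⊆p p _ w∈p-a , x∈p-y⇒x≢y w∈p-a , x∈p-y⇒x≢y w∈p-a-b
  where
  0<∣p-a-b∣ : 0 < ∣ p - a - b ∣
  0<∣p-a-b∣ = s≤s⁻¹ (s≤s⁻¹ (≤-trans 3≤∣p∣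
    (≤-trans (∣p∣≤1+∣p-x∣ p a) (s≤s (∣p∣≤1+∣p-x∣ (p - a) b)))))

Occupied : Subset n → ℕ → Set
Occupied p i = ∃ λ x → x ∈ p × toℕ x ≡ i

Vacant : Subset n → ℕ → Set
Vacant p i = ¬ Occupied p i

occupied? : ∀ (p : Subset n) i → Dec (Occupied p i)
occupied? p i = any? λ x → x ∈? p ×-dec toℕ x ≟ i

Occupied-mono : p ⊆ q → Occupied p i → Occupied q i
Occupied-mono p⊆q (x , x∈p , x≡i) = x , p⊆q x∈p , x≡i

Vacant[p-x] : ∀ (p : Subset n) x → toℕ x ≡ i → Vacant (p - x) i
Vacant[p-x] p x x≡i (y , y∈p-x , y≡i) = x∈p-y⇒x≢y y∈p-x (toℕ-injective (trans y≡i (sym x≡i)))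

Vacant⇒Vacant[p-x] : ∀ (p : Subset n) x → Vacant p i → Vacant (p - x) i
Vacant⇒Vacant[p-x] p x vacant = vacant ∘ Occupied-mono (p─q⊆p p _)

Reach-source : Reach G p x y → x ∈ p
Reach-source (here x∈p)      = x∈p
Reach-source (there x∈p _ _) = x∈p

Reach-snoc : Reach G p x y → G y z → z ∈ p → Reach G p x z
Reach-snoc (here y∈p)         yGz z∈p = there y∈p yGz (here z∈p)
Reach-snoc (there x∈p xGw wy) yGz z∈p = there x∈p xGw (Reach-snoc wy yGz z∈p)

Reach-sym : Symmetric G → Reach G p x y → Reach G p y x
Reach-sym G-sym (here x∈p)         = here x∈p
Reach-sym G-sym (there x∈p xGz zy) = Reach-snoc (Reach-sym G-sym zy) (G-sym xGz) x∈p

P²-sym : Symmetric (P² n)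
P²-sym = swap

P²-step+1 : toℕ y ≡ suc (toℕ x) → P² n x y
P²-step+1 {x = x} y≡ = inj₁ (inj₁ (trans y≡ (+-comm 1 (toℕ x))))

P²-step+2 : toℕ y ≡ suc (suc (toℕ x)) → P² n x y
P²-step+2 {x = x} y≡ = inj₁ (inj₂ (trans y≡ (+-comm 2 (toℕ x))))

P²-bound : P² n x y → toℕ y ≤ toℕ x + 2
P²-bound {x = x} (inj₁ (inj₁ y≡)) = ≤-trans (≤-reflexive y≡) (+-monoʳ-≤ (toℕ x) (n≤1+n 1))
P²-bound         (inj₁ (inj₂ y≡)) = ≤-reflexive y≡
P²-bound {x = x} {y} (inj₂ (inj₁ x≡)) =
  ≤-trans (m≤m+n (toℕ y) 1) (≤-trans (≤-reflexive (sym x≡)) (m≤m+n (toℕ x) 2))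
P²-bound {x = x} {y} (inj₂ (inj₂ x≡)) =
  ≤-trans (m≤m+n (toℕ y) 2) (≤-trans (≤-reflexive (sym x≡)) (m≤m+n (toℕ x) 2))

-- Each edge of P² advances by at most 2, so it cannot jump over two vacant positions.
reach-below-gap : Reach (P² n) p x y → toℕ x < i → Vacant p i → Vacant p (suc i) → toℕ y < i
reach-below-gap (here _)          x<i _      _       = x<i
reach-below-gap (there {z = z} _ xPz zy) x<i vacant vacant′ =
  reach-below-gap zy (≤∧≢⇒< (s≤s⁻¹ (≤∧≢⇒< z≤1+i (vacant′ ∘ occupied))) (vacant ∘ occupied)) vacant vacant′
  where
  z≤1+i = ≤-trans (P²-bound xPz) (≤-trans (≤-reflexive (+-comm _ 2)) (s≤s x<i))
  occupied : ∀ {j} → toℕ z ≡ j → Occupied _ j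
  occupied z≡j = z , Reach-source zy , z≡j

Gapless : Subset n → Set
Gapless p = ∀ {x y} i → x ∈ p → y ∈ p → toℕ x < i → suc i < toℕ y → ¬ (Vacant p i × Vacant p (suc i))

connected⇒gapless : InducesConnected (P² n) p → Gapless p
connected⇒gapless connected i x∈p y∈p x<i 1+i<y (vacant , vacant′) =
  <-asym (reach-below-gap (connected _ _ x∈p y∈p) x<i vacant vacant′) (<-trans (n<1+n i) 1+i<y)

distance-shift : ∀ {a b c} d → a ≡ suc d + b → c ≡ suc b → a ≡ d + c
distance-shift {b = b} d a≡ c≡ = trans a≡ (trans (sym (+-suc d b)) (cong (d +_) (sym c≡)))

gapless-next : Gapless p → x ∈ p → y ∈ p → 3 + toℕ x ≤ toℕ y →
               Occupied p (1 + toℕ x) ⊎ Occupied p (2 + toℕ x)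
gapless-next {p = p} {x = x} gapless x∈p y∈p 3+x≤y
  with occupied? p (1 + toℕ x) | occupied? p (2 + toℕ x)
... | yes occupied | _        = inj₁ occupied
... | no _ | yes occupied     = inj₂ occupied
... | no vacant | no vacant′ =
  contradiction (vacant , vacant′) (gapless (1 + toℕ x) x∈p y∈p ≤-refl 3+x≤y)

module _ {p : Subset n} (gapless : Gapless p) where

  private
    walk : ∀ d → toℕ y ≡ d + toℕ x → x ∈ p → y ∈ p → Reach (P² n) p x y
    walk 0 y≡ x∈p y∈p = subst (Reach (P² n) p _) (toℕ-injective (sym y≡)) (here x∈p)
    walk 1 y≡ x∈p y∈p = there x∈p (P²-step+1 y≡) (here y∈p)
    walk 2 y≡ x∈p y∈p = there x∈p (P²-step+2 y≡) (here y∈p)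
    -- Naming d₁ keeps both recursive calls visibly structural for the termination checker.
    walk {x = x} (suc (suc d₁@(suc d))) y≡ x∈p y∈p =
      [ (λ (z , z∈p , z≡) → there x∈p (P²-step+1 z≡)
          (walk (suc d₁) (distance-shift (suc d₁) y≡ z≡) z∈p y∈p))
      , (λ (z , z∈p , z≡) → there x∈p (P²-step+2 z≡)
          (walk d₁ (distance-shift d₁ (distance-shift (suc d₁) y≡ refl) z≡) z∈p y∈p))
      ]′ (gapless-next gapless x∈p y∈p
           (≤-trans (s≤s (s≤s (s≤s (m≤n+m (toℕ x) d)))) (≤-reflexive (sym y≡))))

  gapless⇒connected : InducesConnected (P² n) p
  gapless⇒connected x y x∈p y∈p with ≤-total (toℕ x) (toℕ y)
  ... | inj₁ x≤y = walk _ (sym (m∸n+n≡m x≤y)) x∈p y∈p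
  ... | inj₂ y≤x = Reach-sym P²-sym (walk _ (sym (m∸n+n≡m y≤x)) y∈p x∈p)

Convex : Subset n → Set
Convex p = ∀ {x y} i → x ∈ p → y ∈ p → toℕ x < i → i < toℕ y → Occupied p i

-- Two vacancies inside C would be two elements of C missing from D.
convex-⊆-gapless : Convex C → D ⊆ C → ∣ C ∣ ≤ suc ∣ D ∣ → Gapless D
convex-⊆-gapless {C = C} {D = D} convex D⊆C ∣C∣≤1+∣D∣ i x∈D y∈D x<i 1+i<y (vacant , vacant′)
  with a , a∈C , a≡i ← convex i (D⊆C x∈D) (D⊆C y∈D) x<i (<-trans (n<1+n i) 1+i<y)
     | b , b∈C , b≡1+i ← convex (suc i) (D⊆C x∈D) (D⊆C y∈D) (m<n⇒m<1+n x<i) 1+i<y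
  = <-irrefl refl (begin-strict
    suc ∣ D ∣          ≤⟨ s≤s (p⊆q⇒∣p∣≤∣q∣ D⊆C-a-b) ⟩
    suc ∣ C - a - b ∣  ≤⟨ x∈p⇒∣p-x∣<∣p∣ b∈C-a ⟩
    ∣ C - a ∣          <⟨ x∈p⇒∣p-x∣<∣p∣ a∈C ⟩
    ∣ C ∣              ≤⟨ ∣C∣≤1+∣D∣ ⟩
    suc ∣ D ∣          ∎)
  where
  open ≤-Reasoning
  b∈C-a : b ∈ C - a
  b∈C-a = x∈p∧x≢y⇒x∈p-y b∈C λ { refl → 1+n≢n (trans (sym b≡1+i) a≡i) }
  D⊆C-a-b : D ⊆ C - a - b
  D⊆C-a-b d∈D = x∈p∧x≢y⇒x∈p-y (x∈p∧x≢y⇒x∈p-y (D⊆C d∈D)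
    λ { refl → vacant (_ , d∈D , a≡i) })
    λ { refl → vacant′ (_ , d∈D , b≡1+i) }

module _ {C : Subset n} (3≤∣C∣ : 3 ≤ ∣ C ∣) (gapless : ∀ {w} → w ∈ C → Gapless (C - w)) where

  -- If x + 2 is vacant too, delete any third element; otherwise a third element
  -- lies beyond x or before x + 2, and deleting x + 2 resp. x opens a double vacancy.
  private
    two-apart⇒≢ : toℕ y ≡ 2 + toℕ x → x ≢ y
    two-apart⇒≢ y≡2+x refl = <⇒≢ (m<n⇒m<1+n (n<1+n _)) y≡2+x

    no-gap-after : x ∈ C → y ∈ C → suc (toℕ x) < toℕ y → ¬ Vacant C (suc (toℕ x))
    no-gap-after {x = x} {y = y} x∈C y∈C 1+x<y vacant with occupied? C (2 + toℕ x)
    ... | no vacant′ =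
      let w , w∈C , w≢x , w≢y = 3≤∣p∣⇒third-element 3≤∣C∣ x y
      in gapless w∈C (suc (toℕ x)) (x∈p∧x≢y⇒x∈p-y x∈C (w≢x ∘ sym)) (x∈p∧x≢y⇒x∈p-y y∈C (w≢y ∘ sym))
           ≤-refl (≤∧≢⇒< 1+x<y (λ 2+x≡y → vacant′ (y , y∈C , sym 2+x≡y)))
           (Vacant⇒Vacant[p-x] C _ vacant , Vacant⇒Vacant[p-x] C _ vacant′)
    ... | yes (c , c∈C , c≡2+x) with 3≤∣p∣⇒third-element 3≤∣C∣ x c
    ...   | w , w∈C , w≢x , w≢c with <-cmp (toℕ w) (toℕ x)
    ...     | tri≈ _ w≡x _ = w≢x (toℕ-injective w≡x)
    ...     | tri< w<x _ _ =
      gapless x∈C (toℕ x) (x∈p∧x≢y⇒x∈p-y w∈C w≢x) (x∈p∧x≢y⇒x∈p-y c∈C (two-apart⇒≢ c≡2+x ∘ sym))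
        w<x (≤-reflexive (sym c≡2+x))
        (Vacant[p-x] C x refl , Vacant⇒Vacant[p-x] C _ vacant)
    ...     | tri> _ _ x<w =
      gapless c∈C (suc (toℕ x)) (x∈p∧x≢y⇒x∈p-y x∈C (two-apart⇒≢ c≡2+x)) (x∈p∧x≢y⇒x∈p-y w∈C w≢c)
        ≤-refl 2+x<w
        (Vacant⇒Vacant[p-x] C _ vacant , Vacant[p-x] C c c≡2+x)
      where
      2+x<w : 2 + toℕ x < toℕ w
      2+x<w = ≤∧≢⇒< (≤∧≢⇒< x<w (λ 1+x≡w → vacant (w , w∈C , sym 1+x≡w)))
                     (λ 2+x≡w → w≢c (toℕ-injective (trans (sym 2+x≡w) (sym c≡2+x))))

    no-vacancy-between : ∀ i → x ∈ C → y ∈ C → toℕ x < i → i < toℕ y → ¬ Vacant C i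
    no-vacancy-between zero    _   _   ()    _
    no-vacancy-between {x = x} (suc i) x∈C y∈C x<1+i 1+i<y with toℕ x ≟ i
    ... | yes refl = no-gap-after x∈C y∈C 1+i<y
    ... | no x≢i with occupied? C i
    ...   | yes (w , w∈C , refl) = no-gap-after w∈C y∈C 1+i<y
    ...   | no vacant = contradiction vacant
      (no-vacancy-between i x∈C y∈C (≤∧≢⇒< (s≤s⁻¹ x<1+i) x≢i) (<-trans (n<1+n i) 1+i<y))

  gapless-deletions⇒convex : Convex C
  gapless-deletions⇒convex i x∈C y∈C x<i i<y =
    decidable-stable (occupied? C i) (no-vacancy-between i x∈C y∈C x<i i<y)

deletion-connected : IsBad (P² n) k C → ∣ C ∣ ≡ suc k → x ∈ C → InducesConnected (P² n) (C - x)
deletion-connected {C = C} (_ , bad) ∣C∣≡1+k x∈C =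
  bad (C - _) (p─q⊆p C _) (suc-injective (trans (x∈p⇒1+∣p-x∣≡∣p∣ x∈C) ∣C∣≡1+k))

bad⇒convex : 2 ≤ k → IsBad (P² n) k C → ∣ C ∣ ≡ suc k → Convex C
bad⇒convex 2≤k bad ∣C∣≡1+k = gapless-deletions⇒convex (subst (3 ≤_) (sym ∣C∣≡1+k) (s≤s 2≤k))
  λ w∈C → connected⇒gapless (deletion-connected bad ∣C∣≡1+k w∈C)

convex⇒bad : Convex C → ∣ C ∣ ≡ suc k → IsBad (P² n) k C
convex⇒bad convex ∣C∣≡1+k = subst (_ ≤_) (sym ∣C∣≡1+k) (n≤1+n _) ,
  λ D D⊆C ∣D∣≡k → gapless⇒connected
    (convex-⊆-gapless convex D⊆C (≤-reflexive (trans ∣C∣≡1+k (cong suc (sym ∣D∣≡k)))))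

interval : ℕ → ℕ → Subset n
interval {zero}  _       _       = []
interval {suc n} (suc m) L       = outside ∷ interval m L
interval {suc n} zero    zero    = ⊥
interval {suc n} zero    (suc L) = inside ∷ interval zero L

∈-interval⁻ : ∀ {n} {x : Fin n} m L → x ∈ interval m L → m ≤ toℕ x × toℕ x < m + L
∈-interval⁻ {x = suc x} (suc m) L       (there x∈) = map s≤s s≤s (∈-interval⁻ m L x∈)
∈-interval⁻ {n = suc n} zero    zero    x∈         = contradiction x∈ ∉⊥
∈-interval⁻ {x = zero}  zero    (suc L) here       = z≤n , s≤s z≤n
∈-interval⁻ {x = suc x} zero    (suc L) (there x∈) = map (λ _ → z≤n) s≤s (∈-interval⁻ zero L x∈)

∈-interval⁺ : ∀ m L → m ≤ toℕ x → toℕ x < m + L → x ∈ interval m L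
∈-interval⁺ {x = suc x} (suc m) L       (s≤s m≤x) (s≤s x<m+L) = there (∈-interval⁺ m L m≤x x<m+L)
∈-interval⁺ {x = zero}  zero    (suc L) _         _           = here
∈-interval⁺ {x = suc x} zero    (suc L) _         (s≤s x<L)   = there (∈-interval⁺ zero L z≤n x<L)

∈-interval : ∀ m L → x ∈ interval m L ⇔ (m ≤ toℕ x × toℕ x < m + L)
∈-interval m L = mk⇔ (∈-interval⁻ m L) (λ (m≤x , x<m+L) → ∈-interval⁺ m L m≤x x<m+L)

∣interval∣ : ∀ m L → m + L ≤ n → ∣ interval {n} m L ∣ ≡ L
∣interval∣ {zero}  zero    zero    _         = refl
∣interval∣ {suc n} (suc m) L       (s≤s m+L≤n) = ∣interval∣ m L m+L≤n
∣interval∣ {suc n} zero    zero    _         = ∣⊥∣≡0 (suc n)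
∣interval∣ {suc n} zero    (suc L) (s≤s L≤n) = cong suc (∣interval∣ zero L L≤n)

interval-occupied : ∀ m L → m ≤ i → i < m + L → i < n → Occupied (interval {n} m L) i
interval-occupied {i = i} m L m≤i i<m+L i<n =
  fromℕ< i<n , ∈-interval⁺ m L (subst (m ≤_) (sym x≡i) m≤i) (subst (_< m + L) (sym x≡i) i<m+L) , x≡i
  where
  x≡i = toℕ-fromℕ< i<n

interval-convex : ∀ m L → Convex (interval {n} m L)
interval-convex m L {x} {y} i x∈ y∈ x<i i<y =
  interval-occupied m L (≤-trans (proj₁ (∈-interval⁻ m L x∈)) (<⇒≤ x<i))
    (<-trans i<y (proj₂ (∈-interval⁻ m L y∈))) (<-trans i<y (toℕ<n y))

IsInterval : ℕ → Subset n → Set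
IsInterval {n} L p = ∃ λ m → m + L ≤ n × p ≡ interval m L

IsInterval⇒∣p∣≡L : ∀ {L} → IsInterval L p → ∣ p ∣ ≡ L
IsInterval⇒∣p∣≡L (m , m+L≤n , refl) = ∣interval∣ m _ m+L≤n

convex-tail : ∀ s → Convex (s ∷ p) → Convex p
convex-tail s convex i x∈ y∈ x<i i<y with convex (suc i) (there x∈) (there y∈) (s≤s x<i) (s≤s i<y)
... | suc w , there w∈ , 1+w≡1+i = w , w∈ , suc-injective 1+w≡1+i

convex-gap⇒empty : Convex (inside ∷ outside ∷ p) → Empty p
convex-gap⇒empty convex (x , x∈) with convex 1 here (there (there x∈)) (s≤s z≤n) (s≤s (s≤s z≤n))
... | suc zero , there () , _

convex-prefix : ∀ {n} {p : Subset n} → Convex (inside ∷ p) → p ≡ interval 0 ∣ p ∣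
convex-prefix {p = []}          _      = refl
convex-prefix {p = inside ∷ p}  convex = cong (inside ∷_) (convex-prefix (convex-tail inside convex))
convex-prefix {suc n} {outside ∷ p} convex
  rewrite Empty-unique (convex-gap⇒empty convex) | ∣⊥∣≡0 n = refl

convex⇒interval : Convex p → IsInterval ∣ p ∣ p
convex⇒interval {p = []}          _      = 0 , z≤n , refl
convex⇒interval {p = outside ∷ p} convex =
  let m , m+∣p∣≤n , p≡ = convex⇒interval (convex-tail outside convex)
  in suc m , s≤s m+∣p∣≤n , cong (outside ∷_) p≡
convex⇒interval {p = inside ∷ p}  convex = 0 , s≤s (∣p∣≤n p) , cong (inside ∷_) (convex-prefix convex)

interval-≢ : ∀ {m m′ L} → m < m′ → m < n → interval {n} m (suc L) ≢ interval m′ (suc L)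
interval-≢ {m = m} {m′} {L} m<m′ m<n m≡m′
  with x , x∈ , x≡m ← interval-occupied m (suc L) ≤-refl (m<m+n m z<s) m<n
  = <⇒≱ m<m′ (subst (m′ ≤_) x≡m (proj₁ (∈-interval⁻ m′ (suc L) (subst (x ∈_) m≡m′ x∈))))

<∸⇒+suc≤ : ∀ m n k → m < n ∸ k → m + suc k ≤ n
<∸⇒+suc≤ m n       zero    m<n   = subst (_≤ n) (+-comm 1 m) m<n
<∸⇒+suc≤ m (suc n) (suc k) m<n∸k =
  subst (_≤ suc n) (sym (+-suc m (suc k))) (s≤s (<∸⇒+suc≤ m n k m<n∸k))

+suc≤⇒<∸ : ∀ m {n k} → m + suc k ≤ n → m < n ∸ k
+suc≤⇒<∸ m {n} {k} m+1+k≤n = m+n≤o⇒m≤o∸n (suc m) (subst (_≤ n) (+-suc m k) m+1+k≤n)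

intervals-count : ∀ n k → HasCount (IsInterval {n} (suc k)) (n ∸ k)
intervals-count n k =
  intervals ,
  applyUpTo⁺₁ _ (n ∸ k) (λ i<j j<n∸k → interval-≢ i<j (<-trans i<j (j<n j<n∸k))) ,
  length-applyUpTo _ (n ∸ k) ,
  λ C → mk⇔ listed⇒interval interval⇒listed
  where
  intervals = applyUpTo (λ m → interval m (suc k)) (n ∸ k)
  j<n : ∀ {j} → j < n ∸ k → j < n
  j<n {j} j<n∸k = ≤-trans (m<m+n j z<s) (<∸⇒+suc≤ j n k j<n∸k)
  listed⇒interval : ∀ {C} → C Listₘ.∈ intervals → IsInterval (suc k) C
  listed⇒interval C∈ with m , m<n∸k , refl ← ∈-applyUpTo⁻ _ C∈ = m , <∸⇒+suc≤ m n k m<n∸k , refl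
  interval⇒listed : ∀ {C} → IsInterval (suc k) C → C Listₘ.∈ intervals
  interval⇒listed (m , m+1+k≤n , refl) = ∈-applyUpTo⁺ _ (+suc≤⇒<∸ m m+1+k≤n)

HasCount-⇔ : ∀ {P Q : Subset n → Set} {r} → (∀ C → P C ⇔ Q C) → HasCount P r → HasCount Q r
HasCount-⇔ P⇔Q (xs , unique , length≡r , ∈⇔P) = xs , unique , length≡r , λ C → P⇔Q C ⇔-∘ ∈⇔P C

bad⇔interval : 2 ≤ k → ∣ C ∣ ≡ suc k → IsBad (P² n) k C ⇔ IsInterval (suc k) C
bad⇔interval {k = k} {C = C} 2≤k ∣C∣≡1+k = mk⇔
  (λ bad → subst (λ L → IsInterval L C) ∣C∣≡1+k (convex⇒interval (bad⇒convex 2≤k bad ∣C∣≡1+k)))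
  (λ (m , _ , C≡) → convex⇒bad (subst Convex (sym C≡) (interval-convex m (suc k))) ∣C∣≡1+k)

bad-of-size⇔interval : 2 ≤ k → (IsBad (P² n) k C × ∣ C ∣ ≡ suc k) ⇔ IsInterval (suc k) C
bad-of-size⇔interval 2≤k = mk⇔
  (λ (bad , ∣C∣≡1+k) → to (bad⇔interval 2≤k ∣C∣≡1+k) bad)
  (λ isInterval → let ∣C∣≡1+k = IsInterval⇒∣p∣≡L isInterval
                  in from (bad⇔interval 2≤k ∣C∣≡1+k) isInterval , ∣C∣≡1+k)

Subset-ext : (∀ x → x ∈ p ⇔ x ∈ q) → p ≡ q
Subset-ext p⇔q = ⊆-antisym (to (p⇔q _)) (from (p⇔q _))

bounds-shift : ∀ m k t → (m ≤ t × t < m + suc k) ⇔ (suc m ≤ t + 1 × t + 1 ≤ suc m + k)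
bounds-shift m k t rewrite +-comm t 1 | +-suc m k = mk⇔ (map₁ s≤s) (map₁ s≤s⁻¹)

∈-interval-one-based : ∀ m k → x ∈ interval m (suc k) ⇔ (suc m ≤ toℕ x + 1 × toℕ x + 1 ≤ suc m + k)
∈-interval-one-based {x = x} m k = bounds-shift m k (toℕ x) ⇔-∘ ∈-interval m (suc k)

interval⇔one-based : IsInterval (suc k) C ⇔
  (Σ ℕ λ s → 1 ≤ s × s ≤ n ∸ k × ((x : Fin n) → x ∈ C ⇔ (s ≤ toℕ x + 1 × toℕ x + 1 ≤ s + k)))
interval⇔one-based {k = k} = mk⇔
  (λ { (m , m+1+k≤n , refl) → suc m , s≤s z≤n , +suc≤⇒<∸ m m+1+k≤n , λ _ → ∈-interval-one-based m k })
  (λ { (suc m , _ , 1+m≤n∸k , C⇔) →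
         m , <∸⇒+suc≤ m _ k 1+m≤n∸k , Subset-ext (λ x → ⇔-sym (∈-interval-one-based m k) ⇔-∘ C⇔ x) })

lemma3p4 : (k n : ℕ) → 2 ≤ k → suc k ≤ n →
    ((C : Subset n) → ∣ C ∣ ≡ suc k →
      (IsBad (P² n) k C ⇔
        Σ ℕ λ s → 1 ≤ s × s ≤ n ∸ k ×
          ((x : Fin n) → x ∈ C ⇔ (s ≤ toℕ x + 1 × toℕ x + 1 ≤ s + k))))
    × q≡ (suc k) (P² n) k (n ∸ k)
lemma3p4 k n 2≤k _ =
  (λ C ∣C∣≡1+k → interval⇔one-based ⇔-∘ bad⇔interval 2≤k ∣C∣≡1+k) ,
  HasCount-⇔ (λ C → ⇔-sym (bad-of-size⇔interval 2≤k)) (intervals-count n k)
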